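{- Let $n\ge 2$ and let $P_n$ be the path on $n$ vertices. Every minimal dominating set of $P_n$ is Complementary Component Dominant, and thus $0_2$-invoking.
   Context: A minimal dominating set is a dominating set none of whose proper subsets obtained by removing one vertex is dominating. $H\subseteq V(G)$ is Complementary Component Dominant (CCD) if (i) for all adjacent $x,y\in H$, $x$ and $y$ have the same number of neighbours in $V(G)\setminus H$, and (ii) for all adjacent $u,v\in V(G)\setminus H$, $u$ and $v$ have the same number of neighbours in $H$. Diffusion: a configuration assigns an integer stack size $|v|$ to each vertex; firing a configuration $C$ changes each $v$ simultaneously from $|v|^C$ to $|v|^C + |\{u\in N(v): |u|^C>|v|^C\}| - |\{u\in N(v): |u|^C<|v|^C\}|$. The 0-configuration has all stack sizes $0$. A perturbation of $H$ from the 0-configuration is the step in which every vertex of $H$ sends one chip to each of its neighbours. $H$ is $0_2$-invoking if this perturbation followed by one ordinary firing yields the 0-configuration. -}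

module Defs where

open import Data.Nat as ℕ using (ℕ; suc; _≡ᵇ_)
open import Data.Integer as ℤ using (ℤ; +_; _-_)
open import Data.Bool using (Bool; true; false; _∧_; _∨_; not; if_then_else_)
open import Data.Fin using (Fin; toℕ)
open import Data.List using (List; map; allFin)
open import Data.Nat.ListAction using (sum)
open import Data.Sum using (_⊎_)
open import Data.Vec using (lookup; updateAt)
open import Data.Fin.Subset using (Subset; ∁)
open import Data.Product using (_×_; ∃)
open import Relation.Nullary.Decidable using (⌊_⌋)
open import Relation.Nullary using (¬_)
open import Relation.Binary.PropositionalEquality using (_≡_)

record Graph (n : ℕ) : Set where
  field
    adj : Fin n → Fin n → Bool

open Graph public

pathGraph : (n : ℕ) → Graph n
pathGraph n = record { adj = λ i j → (suc (toℕ i) ≡ᵇ toℕ j) ∨ (suc (toℕ j) ≡ᵇ toℕ i) }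

mem : ∀ {n} → Fin n → Subset n → Bool
mem u S = lookup S u

countV : ∀ {n} → (Fin n → Bool) → ℕ
countV {n} p = sum (map (λ u → if p u then 1 else 0) (allFin n))

nbrsIn : ∀ {n} → Graph n → Subset n → Fin n → ℕ
nbrsIn G S v = countV (λ u → adj G v u ∧ mem u S)

degree : ∀ {n} → Graph n → Fin n → ℕ
degree G v = countV (λ u → adj G v u)

Dominating : ∀ {n} → Graph n → Subset n → Set
Dominating {n} G D = (v : Fin n) → mem v D ≡ true ⊎ ∃ (λ u → adj G v u ≡ true × mem u D ≡ true)

remove : ∀ {n} → Subset n → Fin n → Subset n
remove S v = updateAt S v (λ _ → false)

MinimalDominating : ∀ {n} → Graph n → Subset n → Set
MinimalDominating {n} G D =
  Dominating G D × ((v : Fin n) → mem v D ≡ true → ¬ Dominating G (remove D v))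

CCD : ∀ {n} → Graph n → Subset n → Set
CCD {n} G H =
  ((x y : Fin n) → mem x H ≡ true → mem y H ≡ true → adj G x y ≡ true →
     nbrsIn G (∁ H) x ≡ nbrsIn G (∁ H) y)
  × ((u v : Fin n) → mem u H ≡ false → mem v H ≡ false → adj G u v ≡ true →
     nbrsIn G H u ≡ nbrsIn G H v)

-- Configurations: integer stack sizes.
Config : ℕ → Set
Config n = Fin n → ℤ

zeroConfig : ∀ {n} → Config n
zeroConfig _ = + 0

fire : ∀ {n} → Graph n → Config n → Config n
fire G C v =
  (C v ℤ.+ + countV (λ u → adj G v u ∧ ⌊ C v ℤ.<? C u ⌋))
    - + countV (λ u → adj G v u ∧ ⌊ C u ℤ.<? C v ⌋)

-- Perturbation of H from the 0-configuration: each vertex of H sends one chip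
-- to each of its neighbours.
perturb : ∀ {n} → Graph n → Subset n → Config n
perturb G H v = + nbrsIn G H v - (if mem v H then + degree G v else + 0)

ZeroTwoInvoking : ∀ {n} → Graph n → Subset n → Set
ZeroTwoInvoking {n} G H = (v : Fin n) → fire G (perturb G H) v ≡ zeroConfig v

-- In a graph of maximum degree two, a vertex has at most one neighbour
-- besides a given one.  So if x, y ∈ D are adjacent, minimality forces x to
-- have a neighbour outside D, which is then its only one; and a vertex outside
-- D next to another outside vertex has exactly one neighbour in D, the one
-- dominating it.  After perturbing
-- a CCD set H, a vertex of H holds minus its number of outside neighbours and
-- a vertex outside H holds its (positive, if it borders H) number of neighbours
-- in H; adjacent vertices on the same side hold equal stacks, so one firing
-- moves exactly these chips back and returns to the 0-configuration.
module Submission where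

open import Defs
open import Data.Nat using (ℕ; _≥_)
open import Data.Fin.Subset using (Subset)
open import Data.Product using (_×_)

open import Data.Nat as ℕ using (zero; suc; _≡ᵇ_; _+_; _≤_)
import Data.Nat.Properties as ℕ
open import Data.Integer as ℤ using (+_; -_; _-_; _<_; _<?_)
import Data.Integer.Properties as ℤ
open import Data.Bool using (Bool; true; false; _∧_; not; if_then_else_)
open import Data.Bool.Properties using (_≟_; ∧-conicalˡ; ∧-conicalʳ; ∧-zeroʳ; ∧-identityʳ; ¬-not; not-injective; ∨-comm; T-∨; T-≡)
open import Data.Fin as Fin using (Fin; toℕ)
open import Data.Fin.Properties using (toℕ-injective; any?; suc-injective; 0≢1+n)
open import Data.List using (allFin; map; tabulate)
open import Data.List.Properties using (map-tabulate)
open import Data.Nat.ListAction using (sum)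
open import Data.Vec.Properties using (lookup-map; lookup∘updateAt′)
open import Data.Fin.Subset using (∁)
open import Data.Sum as Sum using (_⊎_; inj₁; inj₂)
open import Data.Product using (_,_; ∃; proj₁; proj₂)
open import Data.Empty using (⊥-elim)
open import Function using (_∘_; Equivalence)
open import Relation.Nullary using (Dec; ¬_; yes; no; contradiction)
open import Relation.Nullary.Decidable using (⌊_⌋; isYes≗does; dec-true; dec-false)
open import Relation.Binary.PropositionalEquality
open import Data.Integer.Tactic.RingSolver using (solve-∀)

private
  variable
    n : ℕ

countV-suc : (p : Fin (suc n) → Bool) →
             countV p ≡ (if p Fin.zero then 1 else 0) + countV (p ∘ Fin.suc)
countV-suc {n} p = cong₂ _+_ refl (begin
  sum (map f (tabulate Fin.suc))   ≡⟨ cong sum (map-tabulate Fin.suc f) ⟩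
  sum (tabulate (f ∘ Fin.suc))     ≡⟨ cong sum (sym (map-tabulate (λ u → u) (f ∘ Fin.suc))) ⟩
  sum (map (f ∘ Fin.suc) (allFin n)) ∎)
  where
  open ≡-Reasoning
  f : Fin (suc n) → ℕ
  f u = if p u then 1 else 0

countV-cong : {p q : Fin n → Bool} → (∀ u → p u ≡ q u) → countV p ≡ countV q
countV-cong {zero}  eq = refl
countV-cong {suc n} {p} {q} eq = begin
  countV p                                              ≡⟨ countV-suc p ⟩
  (if p Fin.zero then 1 else 0) + countV (p ∘ Fin.suc)  ≡⟨ cong₂ (λ b k → (if b then 1 else 0) + k)
                                                             (eq Fin.zero) (countV-cong (eq ∘ Fin.suc)) ⟩
  (if q Fin.zero then 1 else 0) + countV (q ∘ Fin.suc)  ≡⟨ countV-suc q ⟨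
  countV q                                              ∎
  where open ≡-Reasoning

countV-false : {p : Fin n → Bool} → (∀ u → p u ≡ false) → countV p ≡ 0
countV-false {zero}  none = refl
countV-false {suc n} {p} none
  rewrite countV-suc p | none Fin.zero = countV-false (none ∘ Fin.suc)

countV-pos : {p : Fin n → Bool} (w : Fin n) → p w ≡ true → 1 ≤ countV p
countV-pos {suc n} {p} Fin.zero    pw rewrite countV-suc p | pw = ℕ.s≤s ℕ.z≤n
countV-pos {suc n} {p} (Fin.suc w) pw rewrite countV-suc p =
  ℕ.≤-trans (countV-pos w pw) (ℕ.m≤n+m _ _)

countV-unique : {p : Fin n → Bool} (w : Fin n) → p w ≡ true →
                (∀ u → p u ≡ true → u ≡ w) → countV p ≡ 1
countV-unique {suc n} {p} Fin.zero pw only rewrite countV-suc p | pw =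
  cong suc (countV-false (λ u → ¬-not (λ pu → 0≢1+n (sym (only (Fin.suc u) pu)))))
countV-unique {suc n} {p} (Fin.suc w) pw only
  rewrite countV-suc p | ¬-not (λ p0 → 0≢1+n (only Fin.zero p0)) =
  countV-unique w pw (λ u pu → suc-injective (only (Fin.suc u) pu))

countV-split : (p q : Fin n → Bool) →
               countV p ≡ countV (λ u → p u ∧ q u) + countV (λ u → p u ∧ not (q u))
countV-split {zero}  p q = refl
countV-split {suc n} p q
  rewrite countV-suc p | countV-suc (λ u → p u ∧ q u) | countV-suc (λ u → p u ∧ not (q u))
        | countV-split (p ∘ Fin.suc) (q ∘ Fin.suc)
  with p Fin.zero | q Fin.zero
... | false | _     = refl
... | true  | true  = refl
... | true  | false = sym (ℕ.+-suc _ _)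

Symmetric : Graph n → Set
Symmetric {n} G = (u v : Fin n) → adj G u v ≡ adj G v u

adjacent-sym : {G : Graph n} → Symmetric G → ∀ {u v} → adj G u v ≡ true → adj G v u ≡ true
adjacent-sym adj-sym {u} {v} uv = trans (adj-sym v u) uv

Loopless : Graph n → Set
Loopless {n} G = (v : Fin n) → adj G v v ≡ false

MaxDegreeTwo : Graph n → Set
MaxDegreeTwo {n} G = ∀ {v a b c : Fin n} →
  adj G v a ≡ true → adj G v b ≡ true → adj G v c ≡ true → a ≡ b ⊎ b ≡ c ⊎ a ≡ c

mem-∁ : (H : Subset n) (u : Fin n) → mem u (∁ H) ≡ not (mem u H)
mem-∁ H u = lookup-map u not H

mem-remove : (D : Subset n) {x v : Fin n} → v ≢ x → mem v (remove D x) ≡ mem v D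
mem-remove D {x} {v} v≢x = lookup∘updateAt′ v x v≢x D

module _ {G : Graph n} where

  maxDegreeTwo⇒count≡1 : MaxDegreeTwo G → {q : Fin n → Bool} {v y z : Fin n} →
    adj G v y ≡ true → q y ≡ false → adj G v z ≡ true → q z ≡ true →
    countV (λ u → adj G v u ∧ q u) ≡ 1
  maxDegreeTwo⇒count≡1 maxDeg {q} {v} {y} {z} vy qy vz qz =
    countV-unique z (trans (cong (_∧ q z) vz) qz) only-z
    where
    only-z : ∀ u → adj G v u ∧ q u ≡ true → u ≡ z
    only-z u e with maxDeg (∧-conicalˡ _ _ e) vz vy
    ... | inj₁ u≡z         = u≡z
    ... | inj₂ (inj₁ refl) = contradiction (trans (sym qz) qy) λ ()
    ... | inj₂ (inj₂ refl) = contradiction (trans (sym (∧-conicalʳ _ _ e)) qy) λ ()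

  module _ (adj-sym : Symmetric G) (loopless : Loopless G) where

    adjacent⇒≢ : {x y : Fin n} → adj G x y ≡ true → x ≢ y
    adjacent⇒≢ {x} xy refl = contradiction (trans (sym xy) (loopless x)) λ ()

    dominating-remove : {D : Subset n} {x y : Fin n} → Dominating G D →
      adj G x y ≡ true → mem y D ≡ true → (∀ v → adj G x v ≡ true → mem v D ≡ true) →
      Dominating G (remove D x)
    dominating-remove {D} {x} {y} dom xy yD nbrs⊆D v with v Fin.≟ x
    ... | yes refl = inj₂ (y , xy , trans (mem-remove D (adjacent⇒≢ xy ∘ sym)) yD)
    ... | no v≢x with dom v
    ...   | inj₁ vD = inj₁ (trans (mem-remove D v≢x) vD)
    ...   | inj₂ (u , vu , uD) with u Fin.≟ x
    ...     | no u≢x   = inj₂ (u , vu , trans (mem-remove D u≢x) uD)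
    ...     | yes refl = inj₁ (trans (mem-remove D v≢x) (nbrs⊆D v (trans (adj-sym x v) vu)))

    minimalDominating⇒outsideNeighbour : {D : Subset n} {x y : Fin n} →
      MinimalDominating G D → mem x D ≡ true → adj G x y ≡ true → mem y D ≡ true →
      ∃ λ z → adj G x z ≡ true × mem z D ≡ false
    minimalDominating⇒outsideNeighbour {D} {x} (dom , minimal) xD xy yD
      with any? (λ z → adj G x z ∧ not (mem z D) ≟ true)
    ... | yes (z , e) = z , ∧-conicalˡ _ _ e , not-injective (∧-conicalʳ _ _ e)
    ... | no none = ⊥-elim (minimal x xD (dominating-remove {D} dom xy yD nbrs⊆D))
      where
      nbrs⊆D : ∀ v → adj G x v ≡ true → mem v D ≡ true
      nbrs⊆D v xv = ¬-not λ vD → none (v , cong₂ _∧_ xv (cong not vD))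

    minimalDominating⇒CCD : MaxDegreeTwo G → {D : Subset n} → MinimalDominating G D → CCD G D
    minimalDominating⇒CCD maxDeg {D} minDom@(dom , _) =
      (λ x y xD yD xy → trans (outside≡1 xD xy yD) (sym (outside≡1 yD (swap xy) xD))) ,
      (λ u v uD vD uv → trans (inside≡1 uD uv vD) (sym (inside≡1 vD (swap uv) uD)))
      where
      swap : ∀ {u v} → adj G u v ≡ true → adj G v u ≡ true
      swap = adjacent-sym adj-sym

      outside≡1 : ∀ {x y} → mem x D ≡ true → adj G x y ≡ true → mem y D ≡ true →
                  nbrsIn G (∁ D) x ≡ 1
      outside≡1 {x} {y} xD xy yD with minimalDominating⇒outsideNeighbour {D} minDom xD xy yD
      ... | z , xz , zD =
        maxDegreeTwo⇒count≡1 maxDeg {λ u → mem u (∁ D)}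
          xy (trans (mem-∁ D y) (cong not yD)) xz (trans (mem-∁ D z) (cong not zD))

      inside≡1 : ∀ {u v} → mem u D ≡ false → adj G u v ≡ true → mem v D ≡ false →
                 nbrsIn G D u ≡ 1
      inside≡1 {u} uD uv vD with dom u
      ... | inj₁ uD′ = contradiction (trans (sym uD′) uD) λ ()
      ... | inj₂ (w , uw , wD) = maxDegreeTwo⇒count≡1 maxDeg {λ t → mem t D} uv vD uw wD

degree≡inside+outside : (G : Graph n) (H : Subset n) (v : Fin n) →
                        degree G v ≡ nbrsIn G H v + nbrsIn G (∁ H) v
degree≡inside+outside G H v =
  trans (countV-split (adj G v) (λ u → mem u H))
        (cong₂ _+_ refl (countV-cong λ u → cong (adj G v u ∧_) (sym (mem-∁ H u))))

∧-congˡ-guarded : {a b c : Bool} → (a ≡ true → b ≡ c) → a ∧ b ≡ a ∧ c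
∧-congˡ-guarded {false} _   = refl
∧-congˡ-guarded {true}  b≡c = b≡c refl

⌊⌋-true : {A : Set} (a? : Dec A) → A → ⌊ a? ⌋ ≡ true
⌊⌋-true a? a = trans (isYes≗does a?) (dec-true a? a)

⌊⌋-false : {A : Set} (a? : Dec A) → ¬ A → ⌊ a? ⌋ ≡ false
⌊⌋-false a? ¬a = trans (isYes≗does a?) (dec-false a? ¬a)

module _ {G : Graph n} (adj-sym : Symmetric G) {H : Subset n} (ccd : CCD G H) where

  private
    C : Config n
    C = perturb G H

    swap : ∀ {u v} → adj G u v ≡ true → adj G v u ≡ true
    swap = adjacent-sym adj-sym

  perturb-inside : ∀ {v} → mem v H ≡ true → C v ≡ - + nbrsIn G (∁ H) v
  perturb-inside {v} vH rewrite vH | degree≡inside+outside G H v =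
    cancel (+ nbrsIn G H v) (+ nbrsIn G (∁ H) v)
    where
    cancel : ∀ a b → a - (a ℤ.+ b) ≡ - b
    cancel = solve-∀

  perturb-outside : ∀ {v} → mem v H ≡ false → C v ≡ + nbrsIn G H v
  perturb-outside vH rewrite vH = ℤ.+-identityʳ _

  perturb-inside<outside : ∀ {v u} → adj G v u ≡ true → mem v H ≡ true → mem u H ≡ false →
                           C v < C u
  perturb-inside<outside {v} {u} vu vH uH rewrite perturb-inside vH | perturb-outside uH =
    ℤ.≤-<-trans ℤ.neg-≤-pos (ℤ.+<+ (countV-pos v (cong₂ _∧_ (swap vu) vH)))

  perturb-sameSide : ∀ b {v u} → adj G v u ≡ true → mem v H ≡ b → mem u H ≡ b → C v ≡ C u
  perturb-sameSide true  vu vH uH =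
    trans (perturb-inside vH)
          (trans (cong (-_ ∘ +_) (proj₁ ccd _ _ vH uH vu)) (sym (perturb-inside uH)))
  perturb-sameSide false vu vH uH =
    trans (perturb-outside vH)
          (trans (cong +_ (proj₂ ccd _ _ vH uH vu)) (sym (perturb-outside uH)))

  perturb-ascends : ∀ {v u} → adj G v u ≡ true → ⌊ C v <? C u ⌋ ≡ mem v H ∧ not (mem u H)
  perturb-ascends {v} {u} vu = bySides refl refl
    where
    bySides : ∀ {b c} → mem v H ≡ b → mem u H ≡ c → ⌊ C v <? C u ⌋ ≡ b ∧ not c
    bySides {true}  {true}  vH uH =
      ⌊⌋-false (C v <? C u) (ℤ.<-irrefl (perturb-sameSide true vu vH uH))
    bySides {true}  {false} vH uH =
      ⌊⌋-true (C v <? C u) (perturb-inside<outside vu vH uH)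
    bySides {false} {true}  vH uH =
      ⌊⌋-false (C v <? C u) (ℤ.<-asym (perturb-inside<outside (swap vu) uH vH))
    bySides {false} {false} vH uH =
      ⌊⌋-false (C v <? C u) (ℤ.<-irrefl (perturb-sameSide false vu vH uH))

  fire-inside : ∀ {v} → mem v H ≡ true → fire G C v ≡ + 0
  fire-inside {v} vH = begin
    fire G C v                ≡⟨ cong₂ (λ a b → (C v ℤ.+ + a) - + b) ascending descending ⟩
    (C v ℤ.+ + k) - + 0       ≡⟨ cong (λ c → (c ℤ.+ + k) - + 0) (perturb-inside vH) ⟩
    (- + k ℤ.+ + k) - + 0     ≡⟨ ℤ.+-identityʳ (- + k ℤ.+ + k) ⟩
    - + k ℤ.+ + k             ≡⟨ ℤ.+-inverseˡ (+ k) ⟩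
    + 0                       ∎
    where
    open ≡-Reasoning
    k : ℕ
    k = nbrsIn G (∁ H) v
    ascending : countV (λ u → adj G v u ∧ ⌊ C v <? C u ⌋) ≡ k
    ascending = countV-cong λ u → ∧-congˡ-guarded λ vu →
      trans (perturb-ascends vu) (trans (cong (_∧ not (mem u H)) vH) (sym (mem-∁ H u)))
    descending : countV (λ u → adj G v u ∧ ⌊ C u <? C v ⌋) ≡ 0
    descending = countV-false λ u → trans
      (∧-congˡ-guarded λ vu → trans (perturb-ascends (swap vu))
        (trans (cong (λ b → mem u H ∧ not b) vH) (∧-zeroʳ _)))
      (∧-zeroʳ _)

  fire-outside : ∀ {v} → mem v H ≡ false → fire G C v ≡ + 0
  fire-outside {v} vH = begin
    fire G C v                ≡⟨ cong₂ (λ a b → (C v ℤ.+ + a) - + b) ascending descending ⟩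
    (C v ℤ.+ + 0) - + k       ≡⟨ cong (λ c → (c ℤ.+ + 0) - + k) (perturb-outside vH) ⟩
    (+ k ℤ.+ + 0) - + k       ≡⟨ cong (λ c → c - + k) (ℤ.+-identityʳ (+ k)) ⟩
    + k - + k                 ≡⟨ ℤ.+-inverseʳ (+ k) ⟩
    + 0                       ∎
    where
    open ≡-Reasoning
    k : ℕ
    k = nbrsIn G H v
    ascending : countV (λ u → adj G v u ∧ ⌊ C v <? C u ⌋) ≡ 0
    ascending = countV-false λ u → trans
      (∧-congˡ-guarded λ vu → trans (perturb-ascends vu) (cong (_∧ not (mem u H)) vH))
      (∧-zeroʳ _)
    descending : countV (λ u → adj G v u ∧ ⌊ C u <? C v ⌋) ≡ k
    descending = countV-cong λ u → ∧-congˡ-guarded λ vu →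
      trans (perturb-ascends (swap vu)) (trans (cong (λ b → mem u H ∧ not b) vH) (∧-identityʳ _))

  CCD⇒zeroTwoInvoking : ZeroTwoInvoking G H
  CCD⇒zeroTwoInvoking v = bySide refl
    where
    bySide : ∀ {b} → mem v H ≡ b → fire G C v ≡ + 0
    bySide {true}  = fire-inside
    bySide {false} = fire-outside

sucᵇ-self : ∀ m → (suc m ≡ᵇ m) ≡ false
sucᵇ-self zero    = refl
sucᵇ-self (suc m) = sucᵇ-self m

pathGraph-symmetric : Symmetric (pathGraph n)
pathGraph-symmetric i j = ∨-comm (suc (toℕ i) ≡ᵇ toℕ j) (suc (toℕ j) ≡ᵇ toℕ i)

pathGraph-loopless : Loopless (pathGraph n)
pathGraph-loopless v rewrite sucᵇ-self (toℕ v) = refl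

Nextℕ : ℕ → ℕ → Set
Nextℕ i j = suc i ≡ j ⊎ suc j ≡ i

pathGraph-adj⇒next : {i j : Fin n} → adj (pathGraph n) i j ≡ true → Nextℕ (toℕ i) (toℕ j)
pathGraph-adj⇒next e =
  Sum.map (ℕ.≡ᵇ⇒≡ _ _) (ℕ.≡ᵇ⇒≡ _ _) (Equivalence.to T-∨ (Equivalence.from T-≡ e))

nextℕ-pigeonhole : ∀ {i a b c} → Nextℕ i a → Nextℕ i b → Nextℕ i c → a ≡ b ⊎ b ≡ c ⊎ a ≡ c
nextℕ-pigeonhole (inj₁ p) (inj₁ q) _        = inj₁ (trans (sym p) q)
nextℕ-pigeonhole (inj₂ p) (inj₂ q) _        = inj₁ (ℕ.suc-injective (trans p (sym q)))
nextℕ-pigeonhole (inj₁ p) (inj₂ q) (inj₁ r) = inj₂ (inj₂ (trans (sym p) r))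
nextℕ-pigeonhole (inj₁ p) (inj₂ q) (inj₂ r) = inj₂ (inj₁ (ℕ.suc-injective (trans q (sym r))))
nextℕ-pigeonhole (inj₂ p) (inj₁ q) (inj₁ r) = inj₂ (inj₁ (trans (sym q) r))
nextℕ-pigeonhole (inj₂ p) (inj₁ q) (inj₂ r) = inj₂ (inj₂ (ℕ.suc-injective (trans p (sym r))))

pathGraph-maxDegreeTwo : MaxDegreeTwo (pathGraph n)
pathGraph-maxDegreeTwo va vb vc =
  Sum.map toℕ-injective (Sum.map toℕ-injective toℕ-injective)
    (nextℕ-pigeonhole (pathGraph-adj⇒next va) (pathGraph-adj⇒next vb) (pathGraph-adj⇒next vc))

mainTheorem5 : (n : ℕ) → n ≥ 2 → (D : Subset n) →
    MinimalDominating (pathGraph n) D →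
    CCD (pathGraph n) D × ZeroTwoInvoking (pathGraph n) D
mainTheorem5 n _ D minDom = ccd , CCD⇒zeroTwoInvoking pathGraph-symmetric {D} ccd
  where
  ccd : CCD (pathGraph n) D
  ccd = minimalDominating⇒CCD pathGraph-symmetric pathGraph-loopless
          pathGraph-maxDegreeTwo {D} minDom
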